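{- For every positive integer $k$ there is a set $\{x_1,\dots,x_k\}$ of distinct integers in the range $[1,3k^5]$ such that, for any indices $a,b,c,d,e,f\in\{1,\dots,k\}$, we have $x_a+x_b+x_c=x_d+x_e+x_f$ if and only if the equation holds algebraically, i.e. the multisets $\{a,b,c\}$ and $\{d,e,f\}$ are equal. -}

module Defs where

open import Data.Fin using (Fin)
open import Data.List using (List; _∷_; [])
open import Data.List.Relation.Binary.Permutation.Propositional using (_↭_)

SameMultiset3 : ∀ {k} → (a b c d e f : Fin k) → Set
SameMultiset3 a b c d e f = (a ∷ b ∷ c ∷ []) ↭ (d ∷ e ∷ f ∷ [])

-- Greedy construction. Suppose x₁, …, xⱼ are such that a list of at most h
-- indices is determined up to order by its length and the sum of its values.
-- A new value v can only spoil this if m v + Σ A = Σ B with 1 ≤ m,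
-- m + |A| ≤ h and |B| ≤ h (compare the numbers of copies of v on both sides),
-- that is, if v = (Σ B − Σ A) / m. There are at most h (j+1)^(h−1) (j+1)^h
-- such candidates, which for h = 3 and j < k is at most 3k⁵; so some
-- v ≤ 3k⁵ is not a candidate, and v ≠ 0 because 0 is one.
module Submission where

open import Defs
open import Data.Empty using (⊥-elim)
open import Data.Fin using (Fin; zero; suc; toℕ)
open import Data.Fin.Properties using (pigeonhole; ¬∀⟶∃¬; toℕ≤pred[n])
open import Data.List using (List; []; _∷_; _++_; map; length; replicate; lookup; allFin; upTo; cartesianProductWith)
open import Data.List.Membership.Propositional using (_∈_; _∉_)
open import Data.List.Membership.Propositional.Properties using (∈-allFin; ∈-upTo⁺; ∈-cartesianProductWith⁺)
open import Data.List.Properties using (length-++; length-map; length-upTo; length-tabulate; ∷-injectiveˡ)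
open import Data.List.Relation.Binary.Permutation.Propositional using (_↭_; ↭-refl; ↭-prep; ↭-trans; ↭-sym; module PermutationReasoning)
open import Data.List.Relation.Binary.Permutation.Propositional.Properties using (shift; ++⁺ˡ; map⁺; ↭-singleton-inv)
open import Data.List.Relation.Unary.Any using (here; there; index)
open import Data.List.Relation.Unary.Any.Properties using (lookup-index)
open import Data.Nat using (ℕ; zero; suc; pred; _+_; _*_; _∸_; _^_; _≤_; _<_; _≟_; z≤n; s≤s; s≤s⁻¹)
open import Data.Nat.DivMod using (_/_; m*n/n≡m)
open import Data.Nat.ListAction using (sum)
open import Data.Nat.ListAction.Properties using (sum-↭)
open import Data.Nat.Properties
open import Algebra.Properties.CommutativeSemigroup +-commutativeSemigroup using (x∙yz≈y∙xz)
open import Data.List.Membership.DecPropositional _≟_ using (_∈?_)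
open import Data.Product using (Σ; ∃-syntax; _×_; _,_)
open import Data.Vec.Functional as Vector using (Vector)
open import Function using (_⇔_; mk⇔; _∘_)
open import Function.Definitions using (Injective)
open import Relation.Binary.Definitions using (tri<; tri≈; tri>)
open import Relation.Binary.PropositionalEquality using (_≡_; _≢_; refl; sym; trans; cong; cong₂; subst; module ≡-Reasoning)
open import Relation.Nullary using (¬_)

UniqueSums : ∀ {j} → ℕ → Vector ℕ j → Set
UniqueSums {j} h x = ∀ (L₁ L₂ : List (Fin j)) → length L₁ ≡ length L₂ → length L₁ ≤ h →
  sum (map x L₁) ≡ sum (map x L₂) → L₁ ↭ L₂

Avoids : ∀ {j} → ℕ → Vector ℕ j → ℕ → Set
Avoids {j} h x v = ∀ m (A B : List (Fin j)) → 1 ≤ m → m + length A ≤ h → length B ≤ h →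
  m * v + sum (map x A) ≢ sum (map x B)

unique-sums-[] : ∀ h → UniqueSums h Vector.[]
unique-sums-[] h [] [] _ _ _ = ↭-refl

module _ {j : ℕ} where

  zeros : List (Fin (suc j)) → ℕ
  zeros []          = 0
  zeros (zero  ∷ L) = suc (zeros L)
  zeros (suc _ ∷ L) = zeros L

  nonzeros : List (Fin (suc j)) → List (Fin j)
  nonzeros []          = []
  nonzeros (zero  ∷ L) = nonzeros L
  nonzeros (suc i ∷ L) = i ∷ nonzeros L

  ↭-zeros-nonzeros : ∀ L → L ↭ replicate (zeros L) zero ++ map suc (nonzeros L)
  ↭-zeros-nonzeros []          = ↭-refl
  ↭-zeros-nonzeros (zero  ∷ L) = ↭-prep zero (↭-zeros-nonzeros L)
  ↭-zeros-nonzeros (suc i ∷ L) = ↭-trans (↭-prep (suc i) (↭-zeros-nonzeros L))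
    (↭-sym (shift (suc i) (replicate (zeros L) zero) (map suc (nonzeros L))))

  length-zeros-nonzeros : ∀ L → length L ≡ zeros L + length (nonzeros L)
  length-zeros-nonzeros []          = refl
  length-zeros-nonzeros (zero  ∷ L) = cong suc (length-zeros-nonzeros L)
  length-zeros-nonzeros (suc i ∷ L) =
    trans (cong suc (length-zeros-nonzeros L)) (sym (+-suc (zeros L) _))

  sum-zeros-nonzeros : ∀ v (x : Vector ℕ j) L →
    sum (map (v Vector.∷ x) L) ≡ zeros L * v + sum (map x (nonzeros L))
  sum-zeros-nonzeros v x []          = refl
  sum-zeros-nonzeros v x (zero  ∷ L) =
    trans (cong (v +_) (sum-zeros-nonzeros v x L)) (sym (+-assoc v _ _))
  sum-zeros-nonzeros v x (suc i ∷ L) =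
    trans (cong (x i +_) (sum-zeros-nonzeros v x L)) (x∙yz≈y∙xz (x i) (zeros L * v) _)

m<m+n⇒0<n : ∀ {n m} → n < n + m → 1 ≤ m
m<m+n⇒0<n {n} n<n+m = n≢0⇒n>0 λ { refl → <-irrefl (sym (+-identityʳ n)) n<n+m }

module _ {h j : ℕ} {x : Vector ℕ j} {v : ℕ} (avoid : Avoids h x v) where

  private
    ∑ : List (Fin j) → ℕ
    ∑ L = sum (map x L)

  more-copies-impossible : ∀ n {m} M₁ M₂ → 1 ≤ m →
    n + length M₁ ≡ (n + m) + length M₂ → n + length M₁ ≤ h →
    n * v + ∑ M₁ ≢ (n + m) * v + ∑ M₂
  more-copies-impossible n {m} M₁ M₂ 1≤m lengths bound sums =
    avoid m M₂ M₁ 1≤m (subst (_≤ h) |M₁|≡m+|M₂| |M₁|≤h) |M₁|≤h (sym ∑M₁≡m*v+∑M₂)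
    where
    |M₁|≤h : length M₁ ≤ h
    |M₁|≤h = m+n≤o⇒n≤o n bound

    |M₁|≡m+|M₂| : length M₁ ≡ m + length M₂
    |M₁|≡m+|M₂| = +-cancelˡ-≡ n _ _ (trans lengths (+-assoc n m _))

    ∑M₁≡m*v+∑M₂ : ∑ M₁ ≡ m * v + ∑ M₂
    ∑M₁≡m*v+∑M₂ = +-cancelˡ-≡ (n * v) _ _ (begin
      n * v + ∑ M₁             ≡⟨ sums ⟩
      (n + m) * v + ∑ M₂       ≡⟨ cong (_+ ∑ M₂) (*-distribʳ-+ v n m) ⟩
      n * v + m * v + ∑ M₂     ≡⟨ +-assoc (n * v) (m * v) _ ⟩
      n * v + (m * v + ∑ M₂)   ∎)
      where open ≡-Reasoning

  copies-determined : ∀ {n₁ n₂} M₁ M₂ →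
    n₁ + length M₁ ≡ n₂ + length M₂ → n₁ + length M₁ ≤ h →
    n₁ * v + ∑ M₁ ≡ n₂ * v + ∑ M₂ → n₁ ≡ n₂
  copies-determined {n₁} {n₂} M₁ M₂ lengths bound sums with <-cmp n₁ n₂
  ... | tri≈ _ n₁≡n₂ _ = n₁≡n₂
  ... | tri< n₁<n₂ _ _ with m , refl ← m≤n⇒∃[o]m+o≡n (<⇒≤ n₁<n₂) =
    ⊥-elim (more-copies-impossible n₁ M₁ M₂ (m<m+n⇒0<n n₁<n₂) lengths bound sums)
  ... | tri> _ _ n₂<n₁ with m , refl ← m≤n⇒∃[o]m+o≡n (<⇒≤ n₂<n₁) =
    ⊥-elim (more-copies-impossible n₂ M₂ M₁ (m<m+n⇒0<n n₂<n₁) (sym lengths)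
      (subst (_≤ h) lengths bound) (sym sums))

unique-sums-∷ : ∀ {h j} {x : Vector ℕ j} {v} → UniqueSums h x → Avoids h x v →
  UniqueSums h (v Vector.∷ x)
unique-sums-∷ {h} {x = x} {v} unique avoid L₁ L₂ |L₁|≡|L₂| |L₁|≤h ΣL₁≡ΣL₂ = begin
  L₁                                ↭⟨ ↭-zeros-nonzeros L₁ ⟩
  replicate n₁ zero ++ map suc M₁   ↭⟨ ++⁺ˡ (replicate n₁ zero) (map⁺ suc M₁↭M₂) ⟩
  replicate n₁ zero ++ map suc M₂   ≡⟨ cong (λ n → replicate n zero ++ map suc M₂) n₁≡n₂ ⟩
  replicate n₂ zero ++ map suc M₂   ↭⟨ ↭-sym (↭-zeros-nonzeros L₂) ⟩
  L₂                                ∎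
  where
  open PermutationReasoning
  n₁ = zeros L₁
  n₂ = zeros L₂
  M₁ = nonzeros L₁
  M₂ = nonzeros L₂

  lengths : n₁ + length M₁ ≡ n₂ + length M₂
  lengths = trans (sym (length-zeros-nonzeros L₁)) (trans |L₁|≡|L₂| (length-zeros-nonzeros L₂))

  bound : n₁ + length M₁ ≤ h
  bound = subst (_≤ h) (length-zeros-nonzeros L₁) |L₁|≤h

  sums : n₁ * v + sum (map x M₁) ≡ n₂ * v + sum (map x M₂)
  sums = trans (sym (sum-zeros-nonzeros v x L₁)) (trans ΣL₁≡ΣL₂ (sum-zeros-nonzeros v x L₂))

  n₁≡n₂ : n₁ ≡ n₂
  n₁≡n₂ = copies-determined avoid M₁ M₂ lengths bound sums

  M₁↭M₂ : M₁ ↭ M₂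
  M₁↭M₂ = unique M₁ M₂
    (+-cancelˡ-≡ n₁ _ _ (trans lengths (cong (_+ length M₂) (sym n₁≡n₂))))
    (m+n≤o⇒n≤o n₁ bound)
    (+-cancelˡ-≡ (n₁ * v) _ _ (trans sums (cong (λ n → n * v + sum (map x M₂)) (sym n₁≡n₂))))

length-cartesianProductWith : ∀ {A B C : Set} (f : A → B → C) xs ys →
  length (cartesianProductWith f xs ys) ≡ length xs * length ys
length-cartesianProductWith f []       ys = refl
length-cartesianProductWith f (a ∷ xs) ys = begin
  length (map (f a) ys ++ cartesianProductWith f xs ys)
    ≡⟨ length-++ (map (f a) ys) ⟩
  length (map (f a) ys) + length (cartesianProductWith f xs ys)
    ≡⟨ cong₂ _+_ (length-map (f a) ys) (length-cartesianProductWith f xs ys) ⟩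
  length ys + length xs * length ys ∎
  where open ≡-Reasoning

module _ {j : ℕ} (x : Vector ℕ j) where

  sumsUpTo : ℕ → List ℕ
  sumsUpTo zero    = 0 ∷ []
  sumsUpTo (suc n) = 0 ∷ cartesianProductWith (λ i s → x i + s) (allFin j) (sumsUpTo n)

  ∈-sumsUpTo : ∀ {n} (L : List (Fin j)) → length L ≤ n → sum (map x L) ∈ sumsUpTo n
  ∈-sumsUpTo {zero}  []      _  = here refl
  ∈-sumsUpTo {suc n} []      _  = here refl
  ∈-sumsUpTo {suc n} (i ∷ L) le =
    there (∈-cartesianProductWith⁺ (λ i s → x i + s) (∈-allFin i) (∈-sumsUpTo L (s≤s⁻¹ le)))

  length-sumsUpTo : ∀ n → length (sumsUpTo n) ≤ suc j ^ n
  length-sumsUpTo zero    = ≤-refl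
  length-sumsUpTo (suc n) = begin
    suc (length (cartesianProductWith _ (allFin j) (sumsUpTo n)))
      ≡⟨ cong suc (length-cartesianProductWith _ (allFin j) (sumsUpTo n)) ⟩
    suc (length (allFin j) * length (sumsUpTo n))
      ≡⟨ cong (λ l → suc (l * length (sumsUpTo n))) (length-tabulate {n = j} (λ i → i)) ⟩
    suc (j * length (sumsUpTo n))
      ≤⟨ +-mono-≤ (m^n>0 (suc j) n) (*-monoʳ-≤ j (length-sumsUpTo n)) ⟩
    suc j ^ suc n ∎
    where open ≤-Reasoning

  -- An element m of upTo h stands for the multiplier suc m.
  candidates : ℕ → List ℕ
  candidates h = cartesianProductWith (λ m d → d / suc m) (upTo h)
    (cartesianProductWith (λ a b → b ∸ a) (sumsUpTo (pred h)) (sumsUpTo h))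

  ∈-candidates : ∀ {h v m} (A B : List (Fin j)) → 1 ≤ m → m + length A ≤ h → length B ≤ h →
    m * v + sum (map x A) ≡ sum (map x B) → v ∈ candidates h
  ∈-candidates {h} {v} {suc m} A B _ m+|A|≤h |B|≤h eq =
    subst (_∈ candidates h) quotient
      (∈-cartesianProductWith⁺ (λ m d → d / suc m) (∈-upTo⁺ (m+n≤o⇒m≤o (suc m) m+|A|≤h))
        (∈-cartesianProductWith⁺ (λ a b → b ∸ a)
          (∈-sumsUpTo A (m+n≤o⇒n≤o m (pred-mono-≤ m+|A|≤h)))
          (∈-sumsUpTo B |B|≤h)))
    where
    open ≡-Reasoning
    quotient : (sum (map x B) ∸ sum (map x A)) / suc m ≡ v
    quotient = begin
      (sum (map x B) ∸ sum (map x A)) / suc m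
        ≡⟨ cong (λ b → (b ∸ sum (map x A)) / suc m) (sym eq) ⟩
      (suc m * v + sum (map x A) ∸ sum (map x A)) / suc m
        ≡⟨ cong (_/ suc m) (m+n∸n≡m (suc m * v) (sum (map x A))) ⟩
      suc m * v / suc m
        ≡⟨ cong (_/ suc m) (*-comm (suc m) v) ⟩
      v * suc m / suc m
        ≡⟨ m*n/n≡m v (suc m) ⟩
      v ∎

  length-candidates : ∀ h → length (candidates h) ≤ h * (suc j ^ pred h * suc j ^ h)
  length-candidates h = begin
    length (candidates h)
      ≡⟨ length-cartesianProductWith _ (upTo h) _ ⟩
    length (upTo h) * length (cartesianProductWith _ (sumsUpTo (pred h)) (sumsUpTo h))
      ≡⟨ cong₂ _*_ (length-upTo h) (length-cartesianProductWith _ (sumsUpTo (pred h)) (sumsUpTo h)) ⟩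
    h * (length (sumsUpTo (pred h)) * length (sumsUpTo h))
      ≤⟨ *-monoʳ-≤ h (*-mono-≤ (length-sumsUpTo (pred h)) (length-sumsUpTo h)) ⟩
    h * (suc j ^ pred h * suc j ^ h) ∎
    where open ≤-Reasoning

cannot-cover-range : ∀ N (xs : List ℕ) → length xs ≤ N → ¬ (∀ (w : Fin (suc N)) → toℕ w ∈ xs)
cannot-cover-range N xs |xs|≤N covers
  with u , w , u<w , same-index ← pigeonhole (s≤s |xs|≤N) (index ∘ covers) =
  <-irrefl (trans (lookup-index (covers u))
    (trans (cong (lookup xs) same-index) (sym (lookup-index (covers w))))) u<w

fresh : ∀ N (xs : List ℕ) → length xs ≤ N → ∃[ w ] w ≤ N × w ∉ xs
fresh N xs |xs|≤N
  with w , w∉xs ← ¬∀⟶∃¬ (suc N) (λ w → toℕ w ∈ xs) (λ w → toℕ w ∈? xs)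
                               (cannot-cover-range N xs |xs|≤N) =
  toℕ w , toℕ≤pred[n] w , w∉xs

bounded-unique-sums : ∀ h k → 1 ≤ h → Σ (Vector ℕ k) λ x →
  UniqueSums h x × (∀ i → 1 ≤ x i × x i ≤ h * (k ^ pred h * k ^ h))
bounded-unique-sums h k 1≤h = grow k ≤-refl
  where
  N = h * (k ^ pred h * k ^ h)

  few-candidates : ∀ {j} (x : Vector ℕ j) → j < k → length (candidates x h) ≤ N
  few-candidates x j<k = ≤-trans (length-candidates x h)
    (*-monoʳ-≤ h (*-mono-≤ (^-monoˡ-≤ (pred h) j<k) (^-monoˡ-≤ h j<k)))

  grow : ∀ j → j ≤ k → Σ (Vector ℕ j) λ x → UniqueSums h x × (∀ i → 1 ≤ x i × x i ≤ N)
  grow zero    _   = Vector.[] , unique-sums-[] h , λ ()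
  grow (suc j) j<k with grow j (<⇒≤ j<k)
  ... | x , unique , bounds with fresh N (candidates x h) (few-candidates x j<k)
  ...   | v , v≤N , v∉ = v Vector.∷ x , unique-sums-∷ unique avoid , bounds′
    where
    avoid : Avoids h x v
    avoid m A B 1≤m m+|A|≤h |B|≤h eq = v∉ (∈-candidates x A B 1≤m m+|A|≤h |B|≤h eq)

    bounds′ : ∀ i → 1 ≤ (v Vector.∷ x) i × (v Vector.∷ x) i ≤ N
    bounds′ zero    = n≢0⇒n>0 (λ { refl → v∉ (∈-candidates x {m = 1} [] [] ≤-refl 1≤h z≤n refl) })
                    , v≤N
    bounds′ (suc i) = bounds i

lemma4 : (k : ℕ) → 1 ≤ k →
    Σ (Fin k → ℕ) λ x →
      Injective _≡_ _≡_ x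
      × (∀ i → 1 ≤ x i × x i ≤ 3 * k ^ 5)
      × (∀ a b c d e f →
           (x a + x b + x c ≡ x d + x e + x f) ⇔ SameMultiset3 a b c d e f)
lemma4 k _ with bounded-unique-sums 3 k (s≤s z≤n)
... | x , unique , bounds = x , injective , bounds′ , λ a b c d e f → mk⇔
    (λ eq → unique _ _ refl ≤-refl (trans (sym (sum-triple a b c)) (trans eq (sum-triple d e f))))
    (λ p → trans (sum-triple a b c) (trans (sum-↭ (map⁺ x p)) (sym (sum-triple d e f))))
  where
  sum-triple : ∀ a b c → x a + x b + x c ≡ sum (map x (a ∷ b ∷ c ∷ []))
  sum-triple a b c =
    trans (+-assoc (x a) (x b) (x c)) (cong (λ t → x a + (x b + t)) (sym (+-identityʳ (x c))))

  injective : Injective _≡_ _≡_ x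
  injective {a} {b} xa≡xb =
    ∷-injectiveˡ (↭-singleton-inv (unique (a ∷ []) (b ∷ []) refl (s≤s z≤n) (cong (_+ 0) xa≡xb)))

  bounds′ : ∀ i → 1 ≤ x i × x i ≤ 3 * k ^ 5
  bounds′ i with 1≤xi , xi≤N ← bounds i =
    1≤xi , subst (x i ≤_) (cong (3 *_) (sym (^-distribˡ-+-* k 2 3))) xi≤N
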